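{- Let $c\ge 2$ be an integer and let $\mathcal{G}$ be an ordered graph with $n$ vertices and $n^{1+\varepsilon}$ edges for some $\varepsilon>0$. Then $\overline{R}(\mathcal{G};c)=\Omega(n\,c^{n^{\varepsilon}})$.
   Context: An ordered graph is a finite simple graph with a total ordering of its vertices; a copy of an ordered graph in another is given by an edge-preserving injection of vertices that preserves the orderings. $\mathcal{K}_N$ is the complete graph on $N$ totally ordered vertices. $\overline{R}(\mathcal{G};c)$ is the smallest $N$ such that every coloring of the edges of $\mathcal{K}_N$ with $c$ colors contains a copy of $\mathcal{G}$ all of whose edges have the same color. -}

module Defs where

open import Data.Nat using (ℕ; _+_; _<_)
open import Data.Nat.Properties using (_<?_)
open import Data.Bool using (Bool; true; false; _∧_)
open import Data.Fin using (Fin; toℕ)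
open import Data.List using (List; map; allFin)
open import Data.Nat.ListAction using (sum)
open import Data.Product using (Σ; _×_)
open import Relation.Binary.PropositionalEquality using (_≡_)
open import Relation.Nullary.Decidable using (⌊_⌋)

-- A finite simple graph on the ordered vertex set Fin n (ordered by the
-- usual order of Fin n): a symmetric, irreflexive adjacency relation.
record OrderedGraph (n : ℕ) : Set where
  field
    adj   : Fin n → Fin n → Bool
    sym   : ∀ i j → adj i j ≡ adj j i
    irref : ∀ i → adj i i ≡ false
open OrderedGraph public

edgeIndicator : {n : ℕ} → OrderedGraph n → Fin n → Fin n → ℕ
edgeIndicator G i j with ⌊ toℕ i <? toℕ j ⌋ ∧ adj G i j
... | true  = 1
... | false = 0

edgeCount : {n : ℕ} → OrderedGraph n → ℕ
edgeCount {n} G = sum (map (λ i → sum (map (λ j → edgeIndicator G i j) (allFin n))) (allFin n))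

-- A c-colouring of the edges of the ordered complete graph K_N: the colour of
-- the edge {x,y} with x < y is χ x y (values with x ≥ y are ignored).
Colouring : ℕ → ℕ → Set
Colouring N c = Fin N → Fin N → Fin c

MonoCopy : {n N c : ℕ} → OrderedGraph n → Colouring N c → Set
MonoCopy {n} {N} {c} G χ =
  Σ (Fin n → Fin N) λ φ → Σ (Fin c) λ col →
    (∀ i j → toℕ i < toℕ j → toℕ (φ i) < toℕ (φ j)) ×
    (∀ i j → toℕ i < toℕ j → adj G i j ≡ true → χ (φ i) (φ j) ≡ col)

-- K_N → (G)_c : every c-colouring of K_N has a monochromatic copy of G.
-- R̄(G;c) is the least such N, so  R̄(G;c) ≥ X  iff  every N with Arrows N G c satisfies N ≥ X.
Arrows : {n : ℕ} → ℕ → OrderedGraph n → ℕ → Set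
Arrows N G c = (χ : Colouring N c) → MonoCopy G χ

-- Put M = 2N and suppose every c-colouring of K_N contains a monochromatic copy of G.  Given a
-- c-colouring w of K_M, list the first vertex of every monochromatic copy of G in w.  If at most
-- N vertices were listed, K_N would embed among the unlisted ones, and a monochromatic copy there
-- would have an unlisted first vertex; so every w lists more than N vertices.  A fixed copy is
-- monochromatic in at most a c^(-e) fraction of the colourings, so averaging over w gives
--   c^e (N + 1) ≤ c · #{increasing maps [n] → [M]} ≤ c (2N)^n / n!.
-- As e > n this forces c ≤ 2N, and with n^n ≤ 3^n n! it becomes n^n c^e ≤ (12N)^n.

module Submission where

open import Defs using (OrderedGraph; adj; edgeIndicator; edgeCount; Colouring; Arrows)
open import Data.Bool using (Bool; true; false; not; _∨_; if_then_else_)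
import Data.Bool as Bool
open import Data.Fin using (Fin; zero; suc; toℕ)
open import Data.Fin.Properties using (_≟_; all?; any?)
open import Data.List using (List; []; _∷_; _++_; map; length; allFin; filter; cartesianProductWith; cartesianProduct)
open import Data.List.Properties using (map-tabulate; length-tabulate; length-map; length-++)
open import Data.List.Membership.Propositional using (_∈_)
open import Data.List.Membership.Propositional.Properties using (∈-++⁺ˡ; ∈-++⁺ʳ; ∈-map⁺; ∈-filter⁺; ∈-cartesianProduct⁺; ∈-allFin)
open import Data.List.Relation.Unary.Any using (here)
import Data.List.Relation.Unary.Any as Any
open import Data.Nat using (ℕ; zero; suc; _+_; _*_; _^_; _≤_; _<_; _≤?_; z≤n; s≤s; _!; NonZero; >-nonZero⁻¹)
open import Data.Nat.ListAction using (sum; product)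
open import Data.Nat.Properties hiding (_≟_)
open import Algebra.Properties.CommutativeSemigroup +-commutativeSemigroup using () renaming (interchange to +-interchange)
open import Algebra.Properties.CommutativeSemigroup *-commutativeSemigroup using () renaming (interchange to *-interchange; x∙yz≈y∙xz to *-left-comm)
open import Data.Nat.Tactic.RingSolver using (solve-∀)
open import Data.Product using (Σ; ∃; _×_; _,_; proj₁; proj₂)
import Data.Vec.Functional as Vector
open import Function using (_∘_; id)
open import Relation.Binary.PropositionalEquality
open import Relation.Nullary using (Dec; does; yes; no; contradiction)
open import Relation.Nullary.Decidable using (dec-true; _×-dec_; _→-dec_)
open import Relation.Unary using (Decidable)

private variable
  A B C : Set

𝟙 : Bool → ℕ
𝟙 true  = 1
𝟙 false = 0

𝟙-∨ : ∀ a b → 𝟙 (a ∨ b) ≤ 𝟙 a + 𝟙 b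
𝟙-∨ true  b = s≤s z≤n
𝟙-∨ false b = ≤-refl

*-𝟙-does-≤ : ∀ {P : Set} {k m} (p? : Dec P) → (P → k ≤ m) → k * 𝟙 (does p?) ≤ m
*-𝟙-does-≤ {k = k} (yes p) k≤m = ≤-trans (≤-reflexive (*-identityʳ k)) (k≤m p)
*-𝟙-does-≤ {k = k} (no  _) _   = ≤-trans (≤-reflexive (*-zeroʳ k)) z≤n

𝟙-not+𝟙 : ∀ b → 𝟙 (not b) + 𝟙 b ≡ 1
𝟙-not+𝟙 true  = refl
𝟙-not+𝟙 false = refl

∑ : List A → (A → ℕ) → ℕ
∑ xs f = sum (map f xs)

syntax ∑ xs (λ x → e) = ∑[ x ∈ xs ] e

∏ : List A → (A → ℕ) → ℕ
∏ xs f = product (map f xs)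

syntax ∏ xs (λ x → e) = ∏[ x ∈ xs ] e

map-allFin-suc : ∀ n (f : Fin (suc n) → A) → map f (allFin (suc n)) ≡ f zero ∷ map (f ∘ suc) (allFin n)
map-allFin-suc n f = cong (f zero ∷_) (trans (map-tabulate suc f) (sym (map-tabulate (λ i → i) (f ∘ suc))))

∑-allFin-suc : ∀ n (f : Fin (suc n) → ℕ) → ∑ (allFin (suc n)) f ≡ f zero + ∑ (allFin n) (f ∘ suc)
∑-allFin-suc n f = cong sum (map-allFin-suc n f)

∏-allFin-suc : ∀ n (f : Fin (suc n) → ℕ) → ∏ (allFin (suc n)) f ≡ f zero * ∏ (allFin n) (f ∘ suc)
∏-allFin-suc n f = cong product (map-allFin-suc n f)

length-allFin : ∀ n → length (allFin n) ≡ n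
length-allFin n = length-tabulate {n = n} id

∑-cong : ∀ (xs : List A) {f g : A → ℕ} → (∀ x → f x ≡ g x) → ∑ xs f ≡ ∑ xs g
∑-cong []       f≗g = refl
∑-cong (x ∷ xs) f≗g = cong₂ _+_ (f≗g x) (∑-cong xs f≗g)

∏-cong : ∀ (xs : List A) {f g : A → ℕ} → (∀ x → f x ≡ g x) → ∏ xs f ≡ ∏ xs g
∏-cong []       f≗g = refl
∏-cong (x ∷ xs) f≗g = cong₂ _*_ (f≗g x) (∏-cong xs f≗g)

∑-mono-≤ : ∀ (xs : List A) {f g : A → ℕ} → (∀ x → f x ≤ g x) → ∑ xs f ≤ ∑ xs g
∑-mono-≤ []       f≤g = z≤n
∑-mono-≤ (x ∷ xs) f≤g = +-mono-≤ (f≤g x) (∑-mono-≤ xs f≤g)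

∑-distrib-+ : ∀ (xs : List A) (f g : A → ℕ) → ∑[ x ∈ xs ] (f x + g x) ≡ ∑ xs f + ∑ xs g
∑-distrib-+ []       f g = refl
∑-distrib-+ (x ∷ xs) f g = trans (cong (f x + g x +_) (∑-distrib-+ xs f g)) (+-interchange (f x) (g x) _ _)

*-distribˡ-∑ : ∀ k (xs : List A) (f : A → ℕ) → k * ∑ xs f ≡ ∑[ x ∈ xs ] (k * f x)
*-distribˡ-∑ k []       f = *-zeroʳ k
*-distribˡ-∑ k (x ∷ xs) f = trans (*-distribˡ-+ k (f x) _) (cong (k * f x +_) (*-distribˡ-∑ k xs f))

*-distribʳ-∑ : ∀ k (xs : List A) (f : A → ℕ) → ∑ xs f * k ≡ ∑[ x ∈ xs ] (f x * k)
*-distribʳ-∑ k xs f = trans (*-comm (∑ xs f) k) (trans (*-distribˡ-∑ k xs f) (∑-cong xs (λ x → *-comm k (f x))))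

∑-const : ∀ (xs : List A) k → ∑[ x ∈ xs ] k ≡ length xs * k
∑-const []       k = refl
∑-const (x ∷ xs) k = cong (k +_) (∑-const xs k)

length≡∑1 : ∀ (xs : List A) → length xs ≡ ∑[ x ∈ xs ] 1
length≡∑1 xs = sym (trans (∑-const xs 1) (*-identityʳ (length xs)))

∑-zero : ∀ (xs : List A) → ∑[ x ∈ xs ] 0 ≡ 0
∑-zero xs = trans (∑-const xs 0) (*-zeroʳ (length xs))

∑-comm : ∀ (xs : List A) (ys : List B) (f : A → B → ℕ) →
         ∑[ x ∈ xs ] ∑[ y ∈ ys ] f x y ≡ ∑[ y ∈ ys ] ∑[ x ∈ xs ] f x y
∑-comm []       ys f = sym (∑-zero ys)
∑-comm (x ∷ xs) ys f = begin
  ∑ ys (f x) + ∑[ x′ ∈ xs ] ∑ ys (f x′)         ≡⟨ cong (∑ ys (f x) +_) (∑-comm xs ys f) ⟩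
  ∑ ys (f x) + ∑[ y ∈ ys ] ∑[ x′ ∈ xs ] f x′ y  ≡⟨ ∑-distrib-+ ys (f x) _ ⟨
  ∑[ y ∈ ys ] (f x y + ∑[ x′ ∈ xs ] f x′ y)      ∎
  where open ≡-Reasoning

∑-++ : ∀ (xs ys : List A) (f : A → ℕ) → ∑ (xs ++ ys) f ≡ ∑ xs f + ∑ ys f
∑-++ []       ys f = refl
∑-++ (x ∷ xs) ys f = trans (cong (f x +_) (∑-++ xs ys f)) (sym (+-assoc (f x) _ _))

∑-map : ∀ (g : A → B) (xs : List A) (f : B → ℕ) → ∑ (map g xs) f ≡ ∑ xs (f ∘ g)
∑-map g []       f = refl
∑-map g (x ∷ xs) f = cong (f (g x) +_) (∑-map g xs f)

∑-cartesianProductWith : ∀ (_⊗_ : A → B → C) (xs : List A) (ys : List B) (f : C → ℕ) →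
  ∑ (cartesianProductWith _⊗_ xs ys) f ≡ ∑[ x ∈ xs ] ∑[ y ∈ ys ] f (x ⊗ y)
∑-cartesianProductWith _⊗_ []       ys f = refl
∑-cartesianProductWith _⊗_ (x ∷ xs) ys f = trans (∑-++ (map (x ⊗_) ys) _ f)
  (cong₂ _+_ (∑-map (x ⊗_) ys f) (∑-cartesianProductWith _⊗_ xs ys f))

∏-const : ∀ (xs : List A) k → ∏[ x ∈ xs ] k ≡ k ^ length xs
∏-const []       k = refl
∏-const (x ∷ xs) k = cong (k *_) (∏-const xs k)

^-distribˡ-∑ : ∀ k (xs : List A) (f : A → ℕ) → k ^ ∑ xs f ≡ ∏[ x ∈ xs ] (k ^ f x)
^-distribˡ-∑ k []       f = refl
^-distribˡ-∑ k (x ∷ xs) f = trans (^-distribˡ-+-* k (f x) _) (cong (k ^ f x *_) (^-distribˡ-∑ k xs f))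

length-filter≡∑ : ∀ {P : A → Set} (P? : Decidable P) xs → length (filter P? xs) ≡ ∑[ x ∈ xs ] 𝟙 (does (P? x))
length-filter≡∑ P? []       = refl
length-filter≡∑ P? (x ∷ xs) with does (P? x)
... | true  = cong suc (length-filter≡∑ P? xs)
... | false = length-filter≡∑ P? xs

∑-𝟙-not+∑-𝟙 : ∀ (xs : List A) (f : A → Bool) → ∑[ x ∈ xs ] 𝟙 (not (f x)) + ∑[ x ∈ xs ] 𝟙 (f x) ≡ length xs
∑-𝟙-not+∑-𝟙 xs f = trans (sym (∑-distrib-+ xs _ _)) (trans (∑-cong xs (𝟙-not+𝟙 ∘ f)) (sym (length≡∑1 xs)))

^-distribʳ-* : ∀ m n k → (m * n) ^ k ≡ m ^ k * n ^ k
^-distribʳ-* m n zero    = refl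
^-distribʳ-* m n (suc k) = trans (cong (m * n *_) (^-distribʳ-* m n k)) (*-interchange m n (m ^ k) (n ^ k))

^-cancelʳ-≤ : ∀ k .{{_ : NonZero k}} {m n} → m ^ k ≤ n ^ k → m ≤ n
^-cancelʳ-≤ k {m} {n} mᵏ≤nᵏ with m ≤? n
... | yes m≤n = m≤n
... | no  m≰n = contradiction mᵏ≤nᵏ (<⇒≱ (^-monoˡ-< k (≰⇒> m≰n)))

bernoulli : ∀ m n → m ^ suc n + suc n * m ^ n ≤ suc m ^ suc n
bernoulli m zero    = ≤-reflexive (identity m)
  where
  identity : ∀ m → m * 1 + 1 * 1 ≡ (1 + m) * 1
  identity = solve-∀
bernoulli m (suc n) = begin
  m * (m * mⁿ) + (2 + n) * (m * mⁿ)                  ≤⟨ m≤m+n _ _ ⟩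
  m * (m * mⁿ) + (2 + n) * (m * mⁿ) + (1 + n) * mⁿ   ≡⟨ identity m n mⁿ ⟩
  suc m * (m * mⁿ + suc n * mⁿ)                      ≤⟨ *-monoʳ-≤ (suc m) (bernoulli m n) ⟩
  suc m * suc m ^ suc n                              ∎
  where
  open ≤-Reasoning
  mⁿ : ℕ
  mⁿ = m ^ n
  identity : ∀ m n x → m * (m * x) + (2 + n) * (m * x) + (1 + n) * x ≡ (1 + m) * (m * x + (1 + n) * x)
  identity = solve-∀

-- (1 + 1/k)^j ≤ 1 + j/k + (j/k)², multiplied through by k^(j+2)
[1+k]^j-bound : ∀ k j → j ≤ k → suc k ^ j * (k * k) ≤ k ^ j * (k * k + j * k + j * j)
[1+k]^j-bound k zero    _    = ≤-reflexive (identity k)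
  where
  identity : ∀ k → 1 * (k * k) ≡ 1 * (k * k + 0 * k + 0 * 0)
  identity = solve-∀
[1+k]^j-bound k (suc j) j<k with m≤n⇒∃[o]m+o≡n j<k
... | t , refl = begin
  suc k ^ suc j * (k * k)            ≡⟨ *-assoc (suc k) (suc k ^ j) (k * k) ⟩
  suc k * (suc k ^ j * (k * k))      ≤⟨ *-monoʳ-≤ (suc k) ([1+k]^j-bound k j (<⇒≤ j<k)) ⟩
  suc k * (k ^ j * Q)                ≡⟨ *-left-comm (suc k) (k ^ j) Q ⟩
  k ^ j * (suc k * Q)                ≤⟨ *-monoʳ-≤ (k ^ j) (m≤m+n _ _) ⟩
  k ^ j * (suc k * Q + (2 * j + j * t + 1 + t))                ≡⟨ cong (k ^ j *_) (identity j t) ⟩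
  k ^ j * (k * (k * k + suc j * k + suc j * suc j))            ≡⟨ *-left-comm (k ^ j) k _ ⟩
  k * (k ^ j * (k * k + suc j * k + suc j * suc j))            ≡⟨ *-assoc k (k ^ j) _ ⟨
  k ^ suc j * (k * k + suc j * k + suc j * suc j)               ∎
  where
  open ≤-Reasoning
  Q : ℕ
  Q = k * k + j * k + j * j
  identity : ∀ j t → let k = suc j + t in
    suc k * (k * k + j * k + j * j) + (2 * j + j * t + 1 + t) ≡ k * (k * k + suc j * k + suc j * suc j)
  identity = solve-∀

[1+k]^k≤3*k^k : ∀ k → suc k ^ k ≤ 3 * k ^ k
[1+k]^k≤3*k^k zero        = s≤s z≤n
[1+k]^k≤3*k^k k@(suc _) = *-cancelʳ-≤ _ _ (k * k) (begin
  suc k ^ k * (k * k)               ≤⟨ [1+k]^j-bound k k ≤-refl ⟩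
  k ^ k * (k * k + k * k + k * k)   ≡⟨ identity (k ^ k) (k * k) ⟩
  3 * k ^ k * (k * k)               ∎)
  where
  open ≤-Reasoning
  identity : ∀ a b → a * (b + b + b) ≡ 3 * a * b
  identity = solve-∀

n^n≤3^n*n! : ∀ n → n ^ n ≤ 3 ^ n * n !
n^n≤3^n*n! zero    = ≤-refl
n^n≤3^n*n! (suc n) = begin
  suc n * suc n ^ n            ≤⟨ *-monoʳ-≤ (suc n) ([1+k]^k≤3*k^k n) ⟩
  suc n * (3 * n ^ n)          ≤⟨ *-monoʳ-≤ (suc n) (*-monoʳ-≤ 3 (n^n≤3^n*n! n)) ⟩
  suc n * (3 * (3 ^ n * n !))  ≡⟨ identity (suc n) (3 ^ n) (n !) ⟩
  3 * 3 ^ n * (suc n * n !)    ∎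
  where
  open ≤-Reasoning
  identity : ∀ a b c → a * (3 * (b * c)) ≡ 3 * b * (a * c)
  identity = solve-∀

module _ (n c N e : ℕ) .{{_ : NonZero n}} .{{_ : NonZero c}} (n<e : n < e)
         (bound : n ! * c ^ e * suc N ≤ c * (N + N) ^ n) where

  private
    c≤N+N : c ≤ N + N
    c≤N+N = ^-cancelʳ-≤ n (*-cancelˡ-≤ c (begin
      c * c ^ n               ≤⟨ ^-monoʳ-≤ c n<e ⟩
      c ^ e                   ≤⟨ m≤n*m (c ^ e) (n !) {{n !≢0}} ⟩
      n ! * c ^ e             ≤⟨ m≤m*n (n ! * c ^ e) (suc N) ⟩
      n ! * c ^ e * suc N     ≤⟨ bound ⟩
      c * (N + N) ^ n         ∎))
      where open ≤-Reasoning

    N+N≤2ⁿ*sucN : N + N ≤ 2 ^ n * suc N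
    N+N≤2ⁿ*sucN = begin
      N + N        ≤⟨ +-mono-≤ (n≤1+n N) (≤-trans (n≤1+n N) (m≤m+n (suc N) 0)) ⟩
      2 * suc N    ≤⟨ *-monoˡ-≤ (suc N) (^-monoʳ-≤ 2 (>-nonZero⁻¹ n)) ⟩
      2 ^ n * suc N ∎
      where open ≤-Reasoning

    [12N]ⁿ≡ : (12 * N) ^ n ≡ 3 ^ n * (2 ^ n * (N + N) ^ n)
    [12N]ⁿ≡ = begin
      (12 * N) ^ n                  ≡⟨ cong (_^ n) (identity N) ⟩
      (3 * (2 * (N + N))) ^ n       ≡⟨ ^-distribʳ-* 3 _ n ⟩
      3 ^ n * (2 * (N + N)) ^ n     ≡⟨ cong (3 ^ n *_) (^-distribʳ-* 2 (N + N) n) ⟩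
      3 ^ n * (2 ^ n * (N + N) ^ n) ∎
      where
      open ≡-Reasoning
      identity : ∀ N → 12 * N ≡ 3 * (2 * (N + N))
      identity = solve-∀

  n^n*c^e≤[12*N]^n : n ^ n * c ^ e ≤ (12 * N) ^ n
  n^n*c^e≤[12*N]^n = *-cancelʳ-≤ _ _ (suc N) (begin
    n ^ n * c ^ e * suc N                     ≤⟨ *-monoˡ-≤ (suc N) (*-monoˡ-≤ (c ^ e) (n^n≤3^n*n! n)) ⟩
    3 ^ n * n ! * c ^ e * suc N               ≡⟨ identity (3 ^ n) (n !) (c ^ e) (suc N) ⟩
    3 ^ n * (n ! * c ^ e * suc N)             ≤⟨ *-monoʳ-≤ (3 ^ n) bound ⟩
    3 ^ n * (c * (N + N) ^ n)                 ≤⟨ *-monoʳ-≤ (3 ^ n) (*-monoˡ-≤ ((N + N) ^ n) (≤-trans c≤N+N N+N≤2ⁿ*sucN)) ⟩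
    3 ^ n * (2 ^ n * suc N * (N + N) ^ n)     ≡⟨ identity′ (3 ^ n) (2 ^ n) (suc N) ((N + N) ^ n) ⟩
    3 ^ n * (2 ^ n * (N + N) ^ n) * suc N     ≡⟨ cong (_* suc N) [12N]ⁿ≡ ⟨
    (12 * N) ^ n * suc N                      ∎)
    where
    open ≤-Reasoning
    identity : ∀ a b c d → a * b * c * d ≡ a * (b * c * d)
    identity = solve-∀
    identity′ : ∀ a b c d → a * (b * c * d) ≡ a * (b * d) * c
    identity′ = solve-∀

-- Thinnings: increasing maps between finite ordinals

Increasing : ∀ {n M} → (Fin n → Fin M) → Set
Increasing φ = ∀ i j → toℕ i < toℕ j → toℕ (φ i) < toℕ (φ j)

data Thinning : ℕ → ℕ → Set where
  done : ∀ {M} → Thinning zero M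
  skip : ∀ {n M} → Thinning (suc n) M → Thinning (suc n) (suc M)
  keep : ∀ {n M} → Thinning n M → Thinning (suc n) (suc M)

⟦_⟧ : ∀ {n M} → Thinning n M → Fin n → Fin M
⟦ skip ψ ⟧ i       = suc (⟦ ψ ⟧ i)
⟦ keep ψ ⟧ zero    = zero
⟦ keep ψ ⟧ (suc i) = suc (⟦ ψ ⟧ i)

thinnings : ∀ n M → List (Thinning n M)
thinnings zero    M       = done ∷ []
thinnings (suc n) zero    = []
thinnings (suc n) (suc M) = map skip (thinnings (suc n) M) ++ map keep (thinnings n M)

n!*length-thinnings≤M^n : ∀ n M → n ! * length (thinnings n M) ≤ M ^ n
n!*length-thinnings≤M^n zero    M       = ≤-refl
n!*length-thinnings≤M^n (suc n) zero    = ≤-reflexive (*-zeroʳ (suc n !))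
n!*length-thinnings≤M^n (suc n) (suc M) = begin
  suc n ! * length (map skip S ++ map keep K)      ≡⟨ cong (suc n ! *_) length-split ⟩
  suc n ! * (length S + length K)                  ≡⟨ identity (suc n) (n !) (length S) (length K) ⟩
  suc n ! * length S + suc n * (n ! * length K)    ≤⟨ +-mono-≤ (n!*length-thinnings≤M^n (suc n) M)
                                                              (*-monoʳ-≤ (suc n) (n!*length-thinnings≤M^n n M)) ⟩
  M ^ suc n + suc n * M ^ n                        ≤⟨ bernoulli M n ⟩
  suc M ^ suc n                                    ∎
  where
  open ≤-Reasoning
  S : List (Thinning (suc n) M)
  S = thinnings (suc n) M
  K : List (Thinning n M)
  K = thinnings n M
  length-split : length (map skip S ++ map keep K) ≡ length S + length K
  length-split = trans (length-++ (map skip S)) (cong₂ _+_ (length-map skip S) (length-map keep K))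
  identity : ∀ a f x y → a * f * (x + y) ≡ a * f * x + a * (f * y)
  identity = solve-∀

∑-thinning≤∑ : ∀ {n M} (ψ : Thinning n M) (f : Fin M → ℕ) → ∑[ i ∈ allFin n ] f (⟦ ψ ⟧ i) ≤ ∑ (allFin M) f
∑-thinning≤∑ done f = z≤n
∑-thinning≤∑ {suc n} {suc M} (skip ψ) f rewrite ∑-allFin-suc M f =
  ≤-trans (∑-thinning≤∑ ψ (f ∘ suc)) (m≤n+m _ (f zero))
∑-thinning≤∑ {suc n} {suc M} (keep ψ) f rewrite ∑-allFin-suc M f | ∑-allFin-suc n (f ∘ ⟦ keep ψ ⟧) =
  +-monoʳ-≤ (f zero) (∑-thinning≤∑ ψ (f ∘ suc))

private
  lower-increasing : ∀ {n M} (φ : Fin n → Fin (suc M)) → (∀ i → 0 < toℕ (φ i)) → Increasing φ →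
          ∃ λ φ′ → Increasing φ′ × (∀ i → suc (φ′ i) ≡ φ i)
  lower-increasing {n} {M} φ φ>0 φ↑ = φ′ , φ′↑ , suc∘φ′≗φ
    where
    predecessor : ∀ {M} (x : Fin (suc M)) → 0 < toℕ x → ∃ λ y → suc y ≡ x
    predecessor (suc y) _ = y , refl
    φ′ : Fin n → Fin M
    φ′ i = proj₁ (predecessor (φ i) (φ>0 i))
    suc∘φ′≗φ : ∀ i → suc (φ′ i) ≡ φ i
    suc∘φ′≗φ i = proj₂ (predecessor (φ i) (φ>0 i))
    φ′↑ : Increasing φ′
    φ′↑ i j i<j = ≤-pred (subst₂ (λ x y → toℕ x < toℕ y) (sym (suc∘φ′≗φ i)) (sym (suc∘φ′≗φ j)) (φ↑ i j i<j))

thinnings-complete : ∀ {n M} (φ : Fin n → Fin M) → Increasing φ →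
                     ∃ λ ψ → ψ ∈ thinnings n M × (∀ i → ⟦ ψ ⟧ i ≡ φ i)
thinnings-complete {zero}          φ φ↑ = done , here refl , λ ()
thinnings-complete {suc n} {zero}  φ φ↑ with φ zero
... | ()
thinnings-complete {suc n} {suc M} φ φ↑ with φ zero in φ₀≡
... | zero =
  let φ′ , φ′↑ , suc∘φ′≗φ∘suc = lower-increasing (φ ∘ suc) φ∘suc>0 (λ i j → φ↑ (suc i) (suc j) ∘ s≤s)
      ψ , ψ∈ , ψ≗φ′ = thinnings-complete φ′ φ′↑
  in keep ψ , ∈-++⁺ʳ (map skip (thinnings (suc n) M)) (∈-map⁺ keep ψ∈) ,
     λ { zero → sym φ₀≡ ; (suc i) → trans (cong suc (ψ≗φ′ i)) (suc∘φ′≗φ∘suc i) }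
  where
  φ∘suc>0 : ∀ i → 0 < toℕ (φ (suc i))
  φ∘suc>0 i = subst (λ x → toℕ x < toℕ (φ (suc i))) φ₀≡ (φ↑ zero (suc i) (s≤s z≤n))
... | suc k =
  let φ′ , φ′↑ , suc∘φ′≗φ = lower-increasing φ φ>0 φ↑
      ψ , ψ∈ , ψ≗φ′ = thinnings-complete φ′ φ′↑
  in skip ψ , ∈-++⁺ˡ (∈-map⁺ skip ψ∈) , λ i → trans (cong suc (ψ≗φ′ i)) (suc∘φ′≗φ i)
  where
  φ>0 : ∀ i → 0 < toℕ (φ i)
  φ>0 zero    rewrite φ₀≡ = s≤s z≤n
  φ>0 (suc i) = <-trans (subst (λ x → 0 < toℕ x) (sym φ₀≡) (s≤s z≤n)) (φ↑ zero (suc i) (s≤s z≤n))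

∑-𝟙-≟ : ∀ {n} (a : Fin n) → ∑[ x ∈ allFin n ] 𝟙 (does (x ≟ a)) ≡ 1
∑-𝟙-≟ {suc n} zero    = trans (∑-allFin-suc n (λ x → 𝟙 (does (x ≟ zero)))) (cong suc (∑-zero (allFin n)))
∑-𝟙-≟ {suc n} (suc a) = trans (∑-allFin-suc n (λ x → 𝟙 (does (x ≟ suc a)))) (∑-𝟙-≟ a)

infix 4 _∈?_
_∈?_ : ∀ {M} (x : Fin M) (xs : List (Fin M)) → Dec (x ∈ xs)
x ∈? xs = Any.any? (x ≟_) xs

∑-𝟙-∈≤length : ∀ {M} (xs : List (Fin M)) → ∑[ x ∈ allFin M ] 𝟙 (does (x ∈? xs)) ≤ length xs
∑-𝟙-∈≤length {M} []       = ≤-reflexive (∑-zero (allFin M))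
∑-𝟙-∈≤length {M} (a ∷ xs) = begin
  ∑[ x ∈ allFin M ] 𝟙 (does (x ∈? a ∷ xs))                              ≤⟨ ∑-mono-≤ (allFin M) (λ x → 𝟙-∨ (does (x ≟ a)) _) ⟩
  ∑[ x ∈ allFin M ] (𝟙 (does (x ≟ a)) + 𝟙 (does (x ∈? xs)))                  ≡⟨ ∑-distrib-+ (allFin M) _ _ ⟩
  ∑[ x ∈ allFin M ] 𝟙 (does (x ≟ a)) + ∑[ x ∈ allFin M ] 𝟙 (does (x ∈? xs))  ≤⟨ +-mono-≤ (≤-reflexive (∑-𝟙-≟ a)) (∑-𝟙-∈≤length xs) ⟩
  suc (length xs)                                                    ∎
  where open ≤-Reasoning

N≤∑-𝟙-∉ : ∀ {N} (xs : List (Fin (N + N))) → length xs ≤ N → N ≤ ∑[ x ∈ allFin (N + N) ] 𝟙 (not (does (x ∈? xs)))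
N≤∑-𝟙-∉ {N} xs |xs|≤N = +-cancelʳ-≤ N N _ (begin
  N + N                                     ≡⟨ length-allFin (N + N) ⟨
  length (allFin (N + N))                   ≡⟨ ∑-𝟙-not+∑-𝟙 (allFin (N + N)) (λ x → does (x ∈? xs)) ⟨
  ∑[ x ∈ allFin (N + N) ] 𝟙 (not (does (x ∈? xs))) + ∑[ x ∈ allFin (N + N) ] 𝟙 (does (x ∈? xs))
                                            ≤⟨ +-monoʳ-≤ _ (≤-trans (∑-𝟙-∈≤length xs) |xs|≤N) ⟩
  ∑[ x ∈ allFin (N + N) ] 𝟙 (not (does (x ∈? xs))) + N ∎)
  where open ≤-Reasoning

increasing-into : ∀ {M} (P : Fin M → Bool) N → N ≤ ∑[ x ∈ allFin M ] 𝟙 (P x) →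
                  ∃ λ (e : Fin N → Fin M) → Increasing e × (∀ i → P (e i) ≡ true)
increasing-into {zero}  P zero    _ = (λ ()) , (λ ()) , (λ ())
increasing-into {suc M} P N N≤ with P zero in P₀ | ∑-allFin-suc M (𝟙 ∘ P)
increasing-into {suc M} P zero    N≤ | true | _ = (λ ()) , (λ ()) , (λ ())
increasing-into {suc M} P (suc N) N≤ | true | ∑≡
  with e , e↑ , Pe ← increasing-into (P ∘ suc) N (≤-pred (≤-trans N≤ (≤-reflexive ∑≡))) =
  (λ { zero → zero ; (suc i) → suc (e i) }) ,
  (λ { zero (suc j) _ → s≤s z≤n ; (suc i) (suc j) i<j → s≤s (e↑ i j (≤-pred i<j)) }) ,
  (λ { zero → P₀ ; (suc i) → Pe i })
increasing-into {suc M} P N N≤ | false | ∑≡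
  with e , e↑ , Pe ← increasing-into (P ∘ suc) N (≤-trans N≤ (≤-reflexive ∑≡)) =
  suc ∘ e , (λ i j i<j → s≤s (e↑ i j i<j)) , Pe

-- Counting colourings

functions : ∀ {B : Set} K → List B → List (Fin K → B)
functions zero    bs = (λ ()) ∷ []
functions (suc K) bs = cartesianProductWith Vector._∷_ bs (functions K bs)

∑-functions-∏ : ∀ {B : Set} K (bs : List B) (F : Fin K → B → ℕ) →
  ∑[ w ∈ functions K bs ] ∏[ p ∈ allFin K ] F p (w p) ≡ ∏[ p ∈ allFin K ] ∑ bs (F p)
∑-functions-∏ zero    bs F = refl
∑-functions-∏ (suc K) bs F = begin
  ∑[ w ∈ functions (suc K) bs ] ∏[ p ∈ allFin (suc K) ] F p (w p)
    ≡⟨ ∑-cartesianProductWith Vector._∷_ bs (functions K bs) _ ⟩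
  ∑[ b ∈ bs ] ∑[ w ∈ functions K bs ] ∏[ p ∈ allFin (suc K) ] F p ((b Vector.∷ w) p)
    ≡⟨ ∑-cong bs (λ b → ∑-cong (functions K bs) (λ w → ∏-allFin-suc K (λ p → F p ((b Vector.∷ w) p)))) ⟩
  ∑[ b ∈ bs ] ∑[ w ∈ functions K bs ] (F zero b * ∏[ p ∈ allFin K ] F (suc p) (w p))
    ≡⟨ ∑-cong bs (λ b → *-distribˡ-∑ (F zero b) (functions K bs) _) ⟨
  ∑[ b ∈ bs ] (F zero b * ∑[ w ∈ functions K bs ] ∏[ p ∈ allFin K ] F (suc p) (w p))
    ≡⟨ ∑-cong bs (λ b → cong (F zero b *_) (∑-functions-∏ K bs (F ∘ suc))) ⟩
  ∑[ b ∈ bs ] (F zero b * ∏[ p ∈ allFin K ] ∑ bs (F (suc p)))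
    ≡⟨ *-distribʳ-∑ _ bs (F zero) ⟨
  ∑ bs (F zero) * ∏[ p ∈ allFin K ] ∑ bs (F (suc p))
    ≡⟨ ∏-allFin-suc K (λ p → ∑ bs (F p)) ⟨
  ∏[ p ∈ allFin (suc K) ] ∑ bs (F p) ∎
  where open ≡-Reasoning

∑-functions-∏-uniform : ∀ {B : Set} K (bs : List B) (F : Fin K → B → ℕ) s → (∀ p → ∑ bs (F p) ≡ s) →
  ∑[ w ∈ functions K bs ] ∏[ p ∈ allFin K ] F p (w p) ≡ s ^ K
∑-functions-∏-uniform K bs F s ∑F≡s = begin
  ∑[ w ∈ functions K bs ] ∏[ p ∈ allFin K ] F p (w p)  ≡⟨ ∑-functions-∏ K bs F ⟩
  ∏[ p ∈ allFin K ] ∑ bs (F p)                          ≡⟨ ∏-cong (allFin K) ∑F≡s ⟩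
  ∏[ p ∈ allFin K ] s                                   ≡⟨ ∏-const (allFin K) s ⟩
  s ^ length (allFin K)                                 ≡⟨ cong (s ^_) (length-allFin K) ⟩
  s ^ K                                                 ∎
  where open ≡-Reasoning

length-functions : ∀ {B : Set} K (bs : List B) → length (functions K bs) ≡ length bs ^ K
length-functions K bs = begin
  length (functions K bs)                               ≡⟨ length≡∑1 (functions K bs) ⟩
  ∑[ w ∈ functions K bs ] 1                             ≡⟨ ∑-cong (functions K bs) (λ _ → ∏[1]≡1) ⟨
  ∑[ w ∈ functions K bs ] ∏[ p ∈ allFin K ] 1           ≡⟨ ∑-functions-∏-uniform K bs (λ _ _ → 1) _ (λ _ → sym (length≡∑1 bs)) ⟩
  length bs ^ K                                         ∎
  where
  open ≡-Reasoning
  ∏[1]≡1 : ∏[ p ∈ allFin K ] 1 ≡ 1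
  ∏[1]≡1 = trans (∏-const (allFin K) 1) (^-zeroˡ (length (allFin K)))

colourings : ∀ M c → List (Colouring M c)
colourings M c = functions M (functions M (allFin c))

length-colourings : ∀ M c → length (colourings M c) ≡ (c ^ M) ^ M
length-colourings M c = begin
  length (colourings M c)                ≡⟨ length-functions M (functions M (allFin c)) ⟩
  length (functions M (allFin c)) ^ M    ≡⟨ cong (_^ M) (length-functions M (allFin c)) ⟩
  (length (allFin c) ^ M) ^ M            ≡⟨ cong (λ k → (k ^ M) ^ M) (length-allFin c) ⟩
  (c ^ M) ^ M                            ∎
  where open ≡-Reasoning

Monochromatic : ∀ {n M c} → OrderedGraph n → Colouring M c → (Fin n → Fin M) → Fin c → Set
Monochromatic G w φ col = ∀ i j → toℕ i < toℕ j → adj G i j ≡ true → w (φ i) (φ j) ≡ col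

module _ {n M c : ℕ} (G : OrderedGraph n) (ψ : Thinning n M) (col : Fin c) where

  EdgeImage : Fin M → Fin M → Set
  EdgeImage x y = ∃ λ i → ∃ λ j → toℕ i < toℕ j × adj G i j ≡ true × ⟦ ψ ⟧ i ≡ x × ⟦ ψ ⟧ j ≡ y

  edgeImage? : ∀ x y → Dec (EdgeImage x y)
  edgeImage? x y = any? λ i → any? λ j →
    toℕ i <? toℕ j ×-dec adj G i j Bool.≟ true ×-dec ⟦ ψ ⟧ i ≟ x ×-dec ⟦ ψ ⟧ j ≟ y

  monochromatic? : ∀ w → Dec (Monochromatic G w ⟦ ψ ⟧ col)
  monochromatic? w = all? λ i → all? λ j →
    toℕ i <? toℕ j →-dec adj G i j Bool.≟ true →-dec w (⟦ ψ ⟧ i) (⟦ ψ ⟧ j) ≟ col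

  edgeCount≤#EdgeImage : edgeCount G ≤ ∑[ x ∈ allFin M ] ∑[ y ∈ allFin M ] 𝟙 (does (edgeImage? x y))
  edgeCount≤#EdgeImage = begin
    ∑[ i ∈ allFin n ] ∑[ j ∈ allFin n ] edgeIndicator G i j
      ≤⟨ ∑-mono-≤ (allFin n) (λ i → ∑-mono-≤ (allFin n) (edgeIndicator≤ i)) ⟩
    ∑[ i ∈ allFin n ] ∑[ j ∈ allFin n ] 𝟙 (does (edgeImage? (⟦ ψ ⟧ i) (⟦ ψ ⟧ j)))
      ≤⟨ ∑-mono-≤ (allFin n) (λ i → ∑-thinning≤∑ ψ (λ y → 𝟙 (does (edgeImage? (⟦ ψ ⟧ i) y)))) ⟩
    ∑[ i ∈ allFin n ] ∑[ y ∈ allFin M ] 𝟙 (does (edgeImage? (⟦ ψ ⟧ i) y))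
      ≤⟨ ∑-thinning≤∑ ψ (λ x → ∑[ y ∈ allFin M ] 𝟙 (does (edgeImage? x y))) ⟩
    ∑[ x ∈ allFin M ] ∑[ y ∈ allFin M ] 𝟙 (does (edgeImage? x y)) ∎
    where
    open ≤-Reasoning
    edgeIndicator≤ : ∀ i j → edgeIndicator G i j ≤ 𝟙 (does (edgeImage? (⟦ ψ ⟧ i) (⟦ ψ ⟧ j)))
    edgeIndicator≤ i j with toℕ i <? toℕ j | adj G i j in ij∈G
    ... | no  _   | _     = z≤n
    ... | yes _   | false = z≤n
    ... | yes i<j | true  = ≤-reflexive (cong 𝟙 (sym (dec-true (edgeImage? _ _) (i , j , i<j , ij∈G , refl , refl))))

  -- Every position has total weight c over the colours, so the weights of all colourings add up
  -- to their number, while a monochromatic colouring weighs c^#EdgeImage ≥ c^e.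
  positionWeight : Fin M → Fin M → Fin c → ℕ
  positionWeight x y v = if does (edgeImage? x y) then c * 𝟙 (does (v ≟ col)) else 1

  weight : Colouring M c → ℕ
  weight w = ∏[ x ∈ allFin M ] ∏[ y ∈ allFin M ] positionWeight x y (w x y)

  ∑-positionWeight : ∀ x y → ∑ (allFin c) (positionWeight x y) ≡ c
  ∑-positionWeight x y with does (edgeImage? x y)
  ... | true  = trans (sym (*-distribˡ-∑ c (allFin c) _)) (trans (cong (c *_) (∑-𝟙-≟ col)) (*-identityʳ c))
  ... | false = trans (∑-const (allFin c) 1) (trans (*-identityʳ _) (length-allFin c))

  ∑-weight : ∑ (colourings M c) weight ≡ (c ^ M) ^ M
  ∑-weight = ∑-functions-∏-uniform M _ _ (c ^ M) λ x →
    ∑-functions-∏-uniform M (allFin c) (positionWeight x) c (∑-positionWeight x)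

  c^edgeCount≤weight : .{{_ : NonZero c}} → ∀ w → Monochromatic G w ⟦ ψ ⟧ col → c ^ edgeCount G ≤ weight w
  c^edgeCount≤weight w w-mono = begin
    c ^ edgeCount G                                                   ≤⟨ ^-monoʳ-≤ c edgeCount≤#EdgeImage ⟩
    c ^ (∑[ x ∈ allFin M ] ∑[ y ∈ allFin M ] 𝟙 (does (edgeImage? x y))) ≡⟨ ^-distribˡ-∑ c (allFin M) _ ⟩
    ∏[ x ∈ allFin M ] (c ^ ∑[ y ∈ allFin M ] 𝟙 (does (edgeImage? x y))) ≡⟨ ∏-cong (allFin M) (λ x → ^-distribˡ-∑ c (allFin M) _) ⟩
    ∏[ x ∈ allFin M ] ∏[ y ∈ allFin M ] (c ^ 𝟙 (does (edgeImage? x y))) ≡⟨ ∏-cong (allFin M) (λ x → ∏-cong (allFin M) (positionWeight≡ x)) ⟩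
    weight w                                                          ∎
    where
    open ≤-Reasoning
    positionWeight≡ : ∀ x y → c ^ 𝟙 (does (edgeImage? x y)) ≡ positionWeight x y (w x y)
    positionWeight≡ x y with edgeImage? x y
    ... | no _ = refl
    ... | yes (i , j , i<j , ij∈G , refl , refl) rewrite dec-true (w (⟦ ψ ⟧ i) (⟦ ψ ⟧ j) ≟ col) (w-mono i j i<j ij∈G) = refl

  c^edgeCount*#monochromatic≤#colourings : .{{_ : NonZero c}} →
    c ^ edgeCount G * ∑[ w ∈ colourings M c ] 𝟙 (does (monochromatic? w)) ≤ (c ^ M) ^ M
  c^edgeCount*#monochromatic≤#colourings = begin
    c ^ edgeCount G * ∑[ w ∈ colourings M c ] 𝟙 (does (monochromatic? w))  ≡⟨ *-distribˡ-∑ (c ^ edgeCount G) (colourings M c) (λ w → 𝟙 (does (monochromatic? w))) ⟩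
    ∑[ w ∈ colourings M c ] (c ^ edgeCount G * 𝟙 (does (monochromatic? w))) ≤⟨ ∑-mono-≤ (colourings M c) (λ w → *-𝟙-does-≤ (monochromatic? w) (c^edgeCount≤weight w)) ⟩
    ∑ (colourings M c) weight                                               ≡⟨ ∑-weight ⟩
    (c ^ M) ^ M                                                             ∎
    where open ≤-Reasoning

-- Deleting the first vertices of monochromatic copies

module _ {m : ℕ} (G : OrderedGraph (suc m)) {c : ℕ} .{{_ : NonZero c}} (N : ℕ) where

  private
    M : ℕ
    M = N + N

    Copy : Set
    Copy = Thinning (suc m) M × Fin c

    copies : List Copy
    copies = cartesianProduct (thinnings (suc m) M) (allFin c)

    monochromaticCopy? : ∀ w (copy : Copy) → Dec (Monochromatic G w ⟦ proj₁ copy ⟧ (proj₂ copy))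
    monochromaticCopy? w (ψ , col) = monochromatic? G ψ col w

    firstVertices : Colouring M c → List (Fin M)
    firstVertices w = map (λ (ψ , _) → ⟦ ψ ⟧ zero) (filter (monochromaticCopy? w) copies)

    length-firstVertices : ∀ w → length (firstVertices w) ≡ ∑[ copy ∈ copies ] 𝟙 (does (monochromaticCopy? w copy))
    length-firstVertices w = trans (length-map _ (filter (monochromaticCopy? w) copies)) (length-filter≡∑ (monochromaticCopy? w) copies)

    length-copies : length copies ≡ length (thinnings (suc m) M) * c
    length-copies = begin
      length copies                                        ≡⟨ length≡∑1 copies ⟩
      ∑[ copy ∈ copies ] 1                                 ≡⟨ ∑-cartesianProductWith _,_ (thinnings (suc m) M) (allFin c) _ ⟩
      ∑[ ψ ∈ thinnings (suc m) M ] ∑[ col ∈ allFin c ] 1   ≡⟨ ∑-cong (thinnings (suc m) M) (λ _ → sym (length≡∑1 (allFin c))) ⟩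
      ∑[ ψ ∈ thinnings (suc m) M ] length (allFin c)       ≡⟨ ∑-const (thinnings (suc m) M) _ ⟩
      length (thinnings (suc m) M) * length (allFin c)     ≡⟨ cong (length (thinnings (suc m) M) *_) (length-allFin c) ⟩
      length (thinnings (suc m) M) * c                     ∎
      where open ≡-Reasoning

    firstVertex∈firstVertices : ∀ w (φ : Fin (suc m) → Fin M) col → Increasing φ → Monochromatic G w φ col →
                                φ zero ∈ firstVertices w
    firstVertex∈firstVertices w φ col φ↑ φ-mono =
      let ψ , ψ∈ , ψ≗φ = thinnings-complete φ φ↑
          ψ-mono : Monochromatic G w ⟦ ψ ⟧ col
          ψ-mono i j i<j ij∈G = subst₂ (λ x y → w x y ≡ col) (sym (ψ≗φ i)) (sym (ψ≗φ j)) (φ-mono i j i<j ij∈G)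
      in subst (_∈ firstVertices w) (ψ≗φ zero)
           (∈-map⁺ _ (∈-filter⁺ (monochromaticCopy? w) (∈-cartesianProduct⁺ ψ∈ (∈-allFin col)) ψ-mono))

  arrows⇒N<#firstVertices : Arrows N G c → ∀ w → N < length (firstVertices w)
  arrows⇒N<#firstVertices arrows w = ≰⇒> λ |L|≤N →
    let e , e↑ , e-unlisted = increasing-into unlisted N (N≤∑-𝟙-∉ L |L|≤N)
        φ , col , φ↑ , φ-mono = arrows (λ a b → w (e a) (e b))
        listed = firstVertex∈firstVertices w (e ∘ φ) col (λ i j → e↑ _ _ ∘ φ↑ i j) φ-mono
    in contradiction (trans (sym (cong not (dec-true (e (φ zero) ∈? L) listed))) (e-unlisted (φ zero))) λ ()
    where
    L : List (Fin M)
    L = firstVertices w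
    unlisted : Fin M → Bool
    unlisted x = not (does (x ∈? L))

  arrows⇒c^e*[1+N]≤c*#thinnings : Arrows N G c → c ^ edgeCount G * suc N ≤ c * length (thinnings (suc m) M)
  arrows⇒c^e*[1+N]≤c*#thinnings arrows = *-cancelʳ-≤ _ _ Z {{Z≢0}} (begin
    cᵉ * suc N * Z                                              ≡⟨ *-assoc cᵉ (suc N) Z ⟩
    cᵉ * (suc N * Z)                                            ≡⟨ cong (cᵉ *_) (*-comm (suc N) Z) ⟩
    cᵉ * (Z * suc N)                                            ≡⟨ cong (λ k → cᵉ * (k * suc N)) (length-colourings M c) ⟨
    cᵉ * (length W * suc N)                                     ≡⟨ cong (cᵉ *_) (∑-const W (suc N)) ⟨
    cᵉ * ∑[ w ∈ W ] suc N                                       ≤⟨ *-monoʳ-≤ cᵉ (∑-mono-≤ W (arrows⇒N<#firstVertices arrows)) ⟩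
    cᵉ * ∑[ w ∈ W ] length (firstVertices w)                    ≡⟨ cong (cᵉ *_) (∑-cong W length-firstVertices) ⟩
    cᵉ * ∑[ w ∈ W ] ∑[ copy ∈ copies ] mono w copy              ≡⟨ cong (cᵉ *_) (∑-comm W copies mono) ⟩
    cᵉ * ∑[ copy ∈ copies ] ∑[ w ∈ W ] mono w copy              ≡⟨ *-distribˡ-∑ cᵉ copies _ ⟩
    ∑[ copy ∈ copies ] (cᵉ * ∑[ w ∈ W ] mono w copy)            ≤⟨ ∑-mono-≤ copies (λ (ψ , col) → c^edgeCount*#monochromatic≤#colourings G ψ col) ⟩
    ∑[ copy ∈ copies ] Z                                        ≡⟨ ∑-const copies Z ⟩
    length copies * Z                                           ≡⟨ cong (_* Z) (trans length-copies (*-comm _ c)) ⟩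
    c * length (thinnings (suc m) M) * Z                        ∎)
    where
    open ≤-Reasoning
    cᵉ Z : ℕ
    cᵉ = c ^ edgeCount G
    Z = (c ^ M) ^ M
    W : List (Colouring M c)
    W = colourings M c
    Z≢0 : NonZero Z
    Z≢0 = m^n≢0 (c ^ M) M {{m^n≢0 c M}}
    mono : Colouring M c → Copy → ℕ
    mono w copy = 𝟙 (does (monochromaticCopy? w copy))

proposition2 : Σ ℕ λ p → Σ ℕ λ q → Σ ℕ λ n₀ → (1 ≤ p) × (1 ≤ q) ×
    (∀ (c : ℕ) → 2 ≤ c → ∀ (n : ℕ) → n₀ ≤ n → (G : OrderedGraph n) →
      n < edgeCount G → ∀ (N : ℕ) → Arrows N G c →
      p ^ n * n ^ n * c ^ edgeCount G ≤ (q * N) ^ n)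
proposition2 = 1 , 12 , 1 , ≤-refl , s≤s z≤n , bound
  where
  bound : ∀ c → 2 ≤ c → ∀ n → 1 ≤ n → (G : OrderedGraph n) → n < edgeCount G →
          ∀ N → Arrows N G c → 1 ^ n * n ^ n * c ^ edgeCount G ≤ (12 * N) ^ n
  bound c@(suc _) _ n@(suc _) _ G n<e N arrows = begin
    1 ^ n * n ^ n * c ^ e      ≡⟨ cong (λ k → k * n ^ n * c ^ e) (^-zeroˡ n) ⟩
    1 * n ^ n * c ^ e          ≡⟨ cong (_* c ^ e) (*-identityˡ (n ^ n)) ⟩
    n ^ n * c ^ e              ≤⟨ n^n*c^e≤[12*N]^n n c N e n<e counted ⟩
    (12 * N) ^ n               ∎
    where
    open ≤-Reasoning
    e : ℕ
    e = edgeCount G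
    counted : n ! * c ^ e * suc N ≤ c * (N + N) ^ n
    counted = begin
      n ! * c ^ e * suc N                       ≡⟨ *-assoc (n !) (c ^ e) (suc N) ⟩
      n ! * (c ^ e * suc N)                     ≤⟨ *-monoʳ-≤ (n !) (arrows⇒c^e*[1+N]≤c*#thinnings G N arrows) ⟩
      n ! * (c * length (thinnings n (N + N)))  ≡⟨ *-left-comm (n !) c _ ⟩
      c * (n ! * length (thinnings n (N + N)))  ≤⟨ *-monoʳ-≤ c (n!*length-thinnings≤M^n n (N + N)) ⟩
      c * (N + N) ^ n                           ∎
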